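{- Let $G$ be an abelian group, let $G_0 \subseteq G \setminus \{0\}$ be nonempty and let $H = \mathcal{B}_{\pm}(G_0)$, and assume $\Delta(H) \neq \emptyset$. Let $d = \gcd\{|A| - 2 \colon A \in \mathcal{A}(H)\}$. Then $\min \Delta(H) \mid d$ and $d \mid 2 \min \Delta(H)$. In particular, if $d$ is odd, then $\min \Delta(H) = d$.
   Context: For a subset $G_0$ of an abelian group $G$, a sequence over $G_0$ is a finite unordered list $S = g_1\cdots g_\ell$ of elements of $G_0$ (repetitions allowed), forming the free commutative monoid over $G_0$ under concatenation; $|S|=\ell$. $S$ is a plus-minus weighted zero-sum sequence if $\sum_i \epsilon_i g_i = 0$ for some $\epsilon_i\in\{+1,-1\}$; $\mathcal{B}_{\pm}(G_0)$ is the monoid of these. For a monoid $H$ with trivial unit group: an atom is a non-identity element not a product of two non-identity elements, and $\mathcal{A}(H)$ is the set of atoms; $\mathsf{L}_H(a)$ is the set of $k$ such that $a$ is a product of $k$ atoms; for finite $L=\{a_0<\dots<a_k\}$, $\Delta(L)=\{a_i-a_{i-1}\}$; $\Delta(H)=\bigcup_{a\in H}\Delta(\mathsf{L}_H(a))$. -}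

module Defs where

open import Level using (Level; _⊔_)
open import Algebra.Bundles using (AbelianGroup)
open import Data.Bool using (Bool; true; false)
open import Data.Nat using (ℕ; _≤_; _<_)
open import Data.Nat.Divisibility using (_∣_)
open import Data.List using (List; []; _∷_; _++_; length; concat)
open import Data.List.Relation.Unary.All using (All)
open import Data.Product using (Σ; ∃; _×_)
open import Relation.Nullary using (¬_)
open import Relation.Binary.PropositionalEquality using (_≡_)
import Data.List.Relation.Binary.Permutation.Setoid as Perm

module _ {c ℓ : Level} (G : AbelianGroup c ℓ) where
  open AbelianGroup G

  -- Sequences over G₀ are lists of group elements all lying in G₀;
  -- equality of sequences (unordered lists) is permutation up to ≈.
  _≋ₛ_ : List Carrier → List Carrier → Set (c ⊔ ℓ)
  _≋ₛ_ = Perm._↭_ setoid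

  signedSum : List Bool → List Carrier → Carrier
  signedSum (true ∷ es)  (g ∷ gs) = g ∙ signedSum es gs
  signedSum (false ∷ es) (g ∷ gs) = (g ⁻¹) ∙ signedSum es gs
  signedSum _ _ = ε

  IsPMZeroSum : List Carrier → Set ℓ
  IsPMZeroSum S = Σ (List Bool) λ es → length es ≡ length S × signedSum es S ≈ ε

  module _ {p : Level} (G₀ : Carrier → Set p) where

    InH : List Carrier → Set (c ⊔ ℓ ⊔ p)
    InH S = All G₀ S × IsPMZeroSum S

    IsAtom : List Carrier → Set (c ⊔ ℓ ⊔ p)
    IsAtom A = InH A × ¬ (A ≋ₛ [])
             × ¬ (Σ (List Carrier) λ B → Σ (List Carrier) λ C →
                    InH B × InH C × ¬ (B ≋ₛ []) × ¬ (C ≋ₛ []) × A ≋ₛ (B ++ C))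

    InLengthSet : List Carrier → ℕ → Set (c ⊔ ℓ ⊔ p)
    InLengthSet a k = Σ (List (List Carrier)) λ As →
      length As ≡ k × All IsAtom As × a ≋ₛ concat As

    InDelta : ℕ → Set (c ⊔ ℓ ⊔ p)
    InDelta δ = Σ (List Carrier) λ a → Σ ℕ λ k →
      InH a × 1 ≤ δ × InLengthSet a k × InLengthSet a (k Data.Nat.+ δ)
      × (∀ l → InLengthSet a l → k < l → l < k Data.Nat.+ δ → Data.Empty.⊥)
      where import Data.Empty

    IsMinDelta : ℕ → Set (c ⊔ ℓ ⊔ p)
    IsMinDelta m = InDelta m × (∀ δ → InDelta δ → m ≤ δ)

    -- d = gcd{ |A| - 2 : A ∈ 𝓐(H) }  (every atom has length ≥ 2 since 0 ∉ G₀)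
    IsAtomLengthGcd : ℕ → Set (c ⊔ ℓ ⊔ p)
    IsAtomLengthGcd d =
      (∀ A → IsAtom A → d ∣ (length A Data.Nat.∸ 2))
      × (∀ e → (∀ A → IsAtom A → e ∣ (length A Data.Nat.∸ 2)) → e ∣ d)

{-# OPTIONS --safe #-}
-- First, the square A·A of an atom A is a product of 2
-- atoms and also of the |A| atoms g·g (g ∈ A, signs +g - g), so it has lengths 2 and |A|;
-- multiplying by the Q-th power of an element with lengths k and k + min Δ(H), where
-- |A| - 2 = Q · min Δ(H) + r, produces two lengths at distance r < min Δ(H), forcing
-- r = 0. Second, a product of k atoms has length 2k modulo d, so two factorisations
-- of lengths k and k + δ give d ∣ 2δ. For odd d, d ∣ 2 · min Δ(H) already gives d ∣ min Δ(H).
module Submission where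

open import Defs
open import Level using (Level)
open import Algebra.Bundles using (AbelianGroup)
open import Data.Nat using (ℕ; _*_)
open import Data.Nat.Divisibility using (_∣_)
open import Data.Product using (Σ; _×_)
open import Relation.Nullary using (¬_)
open import Relation.Binary.PropositionalEquality using (_≡_)
open import Relation.Binary.Definitions using (_Respects_)

import Algebra.Properties.Group as GroupProperties
open import Data.Bool using (true; false)
open import Data.Empty using (⊥; ⊥-elim)
open import Data.List using (List; []; _∷_; _++_; length; concat; map; replicate)
open import Data.List.Properties using (length-++; length-++-sucʳ; length-map; ++-identityʳ; concat-++)
open import Data.List.Relation.Unary.All using (All; []; _∷_)
import Data.List.Relation.Unary.All.Properties as All
import Data.List.Relation.Binary.Permutation.Setoid as Permutation
import Data.List.Relation.Binary.Permutation.Setoid.Properties as PermutationProperties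
open import Data.Nat using (zero; suc; _+_; _∸_; _≤_; _<_; _≮_; s≤s; z≤n; NonZero; >-nonZero)
open import Data.Nat.Properties
open import Data.Nat.Divisibility using (_∣0; ∣m∣n⇒∣m+n; ∣m+n∣m⇒∣n; m%n≡0⇒n∣m; ∣-antisym)
open import Data.Nat.DivMod using (_%_; _/_; m≡m%n+[m/n]*n; m%n<n)
open import Data.Nat.Coprimality using (Coprime; coprime-divisor)
open import Data.Nat.Primality using (irreducible[2])
open import Data.Nat.Induction using (<-wellFounded)
open import Data.Nat.Tactic.RingSolver using (solve-∀)
open import Data.Product using (_,_; proj₁; ∃-syntax)
open import Data.Sum using ([_,_]′)
open import Function using (id)
open import Induction.WellFounded using (Acc; acc)
import Relation.Binary.PropositionalEquality as ≡
open ≡.≡-Reasoning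

n<m∧[0<n⇒m≤n]⇒n≡0 : ∀ {m n} → n < m → (1 ≤ n → m ≤ n) → n ≡ 0
n<m∧[0<n⇒m≤n]⇒n≡0 {n = zero}  _   _        = ≡.refl
n<m∧[0<n⇒m≤n]⇒n≡0 {n = suc n} n<m 0<n⇒m≤n = ⊥-elim (<⇒≱ n<m (0<n⇒m≤n (s≤s z≤n)))

module _ {c ℓ p : Level} (G : AbelianGroup c ℓ) (G₀ : AbelianGroup.Carrier G → Set p) where
  open AbelianGroup G
  open GroupProperties group using (ε⁻¹≈ε; ⁻¹-involutive)
  open Permutation setoid using (↭-refl; ↭-trans; ↭-prep; ↭-reflexive)
  open PermutationProperties setoid using (xs↭ys⇒|xs|≡|ys|; ¬x∷xs↭[]; ↭-shift; ++⁺)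

  signedSum-++ : ∀ es S {es′ S′} → length es ≡ length S →
                 signedSum G (es ++ es′) (S ++ S′) ≈ signedSum G es S ∙ signedSum G es′ S′
  signedSum-++ []           []      _  = sym (identityˡ _)
  signedSum-++ (true ∷ es)  (g ∷ S) eq =
    trans (∙-congˡ (signedSum-++ es S (suc-injective eq))) (sym (assoc _ _ _))
  signedSum-++ (false ∷ es) (g ∷ S) eq =
    trans (∙-congˡ (signedSum-++ es S (suc-injective eq))) (sym (assoc _ _ _))

  InH-++ : ∀ {a b} → InH G G₀ a → InH G G₀ b → InH G G₀ (a ++ b)
  InH-++ {a} {b} (a⊆G₀ , es , |es| , Σa≈ε) (b⊆G₀ , es′ , |es′| , Σb≈ε) =
    All.++⁺ a⊆G₀ b⊆G₀ , es ++ es′ ,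
    ≡.trans (length-++ es) (≡.trans (≡.cong₂ _+_ |es| |es′|) (≡.sym (length-++ a))) ,
    trans (signedSum-++ es a |es|) (trans (∙-cong Σa≈ε Σb≈ε) (identityˡ ε))

  InH-power : ∀ {a} n → InH G G₀ a → InH G G₀ (concat (replicate n a))
  InH-power zero    _   = [] , [] , ≡.refl , refl
  InH-power (suc n) a∈H = InH-++ a∈H (InH-power n a∈H)

  InLengthSet-++ : ∀ {a b k l} → InLengthSet G G₀ a k → InLengthSet G G₀ b l →
                   InLengthSet G G₀ (a ++ b) (k + l)
  InLengthSet-++ (As , |As| , As-atoms , a↭As) (Bs , |Bs| , Bs-atoms , b↭Bs) =
    As ++ Bs , ≡.trans (length-++ As) (≡.cong₂ _+_ |As| |Bs|) , All.++⁺ As-atoms Bs-atoms ,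
    ↭-trans (++⁺ a↭As b↭Bs) (↭-reflexive (concat-++ As Bs))

  InLengthSet-power : ∀ {a k} n → InLengthSet G G₀ a k →
                      InLengthSet G G₀ (concat (replicate n a)) (n * k)
  InLengthSet-power zero    _   = [] , ≡.refl , [] , ↭-refl
  InLengthSet-power (suc n) k∈L = InLengthSet-++ k∈L (InLengthSet-power n k∈L)

  pair : Carrier → List Carrier
  pair g = g ∷ g ∷ []

  ++-self↭pairs : ∀ A → _≋ₛ_ G (A ++ A) (concat (map pair A))
  ++-self↭pairs []      = ↭-refl
  ++-self↭pairs (g ∷ A) = ↭-prep g (↭-trans (↭-shift A A) (↭-prep g (++-self↭pairs A)))

  -- Between two lengths at distance r there are consecutive lengths at distance ≤ r;
  -- since membership in a length set is undecidable, this is phrased as a lower bound.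
  minΔ≤lengthGap : ∀ {m a k} → (∀ δ → InDelta G G₀ δ → m ≤ δ) → InH G G₀ a →
                   ∀ r → InLengthSet G G₀ a k → InLengthSet G G₀ a (k + r) → 1 ≤ r → m ≤ r
  minΔ≤lengthGap {m} {a} m≤Δ a∈H r k∈L k+r∈L 1≤r =
    ≮⇒≥ (gap≮minΔ r (<-wellFounded r) k∈L k+r∈L 1≤r)
    where
    gap≮minΔ : ∀ {k} r → Acc _<_ r → InLengthSet G G₀ a k → InLengthSet G G₀ a (k + r) →
               1 ≤ r → r ≮ m
    gap≮minΔ {k} r (acc smaller) k∈L k+r∈L 1≤r r<m =
      <⇒≱ r<m (m≤Δ r (a , k , a∈H , 1≤r , k∈L , k+r∈L , noLengthBetween))
      where
      noLengthBetween : ∀ l → InLengthSet G G₀ a l → k < l → l < k + r → ⊥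
      noLengthBetween l l∈L k<l l<k+r =
        gap≮minΔ (l ∸ k) (smaller l∸k<r) k∈L (≡.subst (InLengthSet G G₀ a) (≡.sym k+[l∸k]≡l) l∈L)
          (m<n⇒0<n∸m k<l) (<-trans l∸k<r r<m)
        where
        k+[l∸k]≡l : k + (l ∸ k) ≡ l
        k+[l∸k]≡l = m+[n∸m]≡n (<⇒≤ k<l)
        l∸k<r : l ∸ k < r
        l∸k<r = +-cancelˡ-< k (l ∸ k) r (≡.subst (_< k + r) (≡.sym k+[l∸k]≡l) l<k+r)

  module _ (zero-free : ∀ g → G₀ g → ¬ g ≈ ε) where

    ¬InH-[_] : ∀ g → ¬ InH G G₀ (g ∷ [])
    ¬InH-[ g ] (g∈G₀ ∷ [] , true ∷ [] , _ , g∙ε≈ε) =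
      zero-free g g∈G₀ (trans (sym (identityʳ g)) g∙ε≈ε)
    ¬InH-[ g ] (g∈G₀ ∷ [] , false ∷ [] , _ , g⁻¹∙ε≈ε) =
      zero-free g g∈G₀ (trans (sym (⁻¹-involutive g))
        (trans (⁻¹-cong (trans (sym (identityʳ (g ⁻¹))) g⁻¹∙ε≈ε)) ε⁻¹≈ε))

    IsAtom⇒2≤length : ∀ {A} → IsAtom G G₀ A → 2 ≤ length A
    IsAtom⇒2≤length {[]}        (_ , A≉[] , _) = ⊥-elim (A≉[] ↭-refl)
    IsAtom⇒2≤length {g ∷ []}    (A∈H , _)      = ⊥-elim (¬InH-[ g ] A∈H)
    IsAtom⇒2≤length {_ ∷ _ ∷ _} _              = s≤s (s≤s z≤n)

    pair-IsAtom : ∀ {g} → G₀ g → IsAtom G G₀ (pair g)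
    pair-IsAtom {g} g∈G₀ =
      (g∈G₀ ∷ g∈G₀ ∷ [] , true ∷ false ∷ [] , ≡.refl ,
        trans (∙-congˡ (identityʳ (g ⁻¹))) (inverseʳ g)) ,
      ¬x∷xs↭[] ,
      λ (B , C , B∈H , _ , B≉[] , C≉[] , pair↭B++C) → indecomposable B C B∈H B≉[] C≉[] pair↭B++C
      where
      indecomposable : ∀ B C → InH G G₀ B → ¬ _≋ₛ_ G B [] → ¬ _≋ₛ_ G C [] →
                       ¬ _≋ₛ_ G (pair g) (B ++ C)
      indecomposable []              _       _   B≉[] _    _ = B≉[] ↭-refl
      indecomposable (b ∷ [])        _       B∈H _    _    _ = ¬InH-[ b ] B∈H
      indecomposable (_ ∷ _ ∷ _)     []      _   _    C≉[] _ = C≉[] ↭-refl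
      indecomposable (_ ∷ _ ∷ B)     (c ∷ C) _   _    _    pair↭B++C =
        0≢1+n (≡.trans (suc-injective (suc-injective (xs↭ys⇒|xs|≡|ys| pair↭B++C)))
                       (length-++-sucʳ B c C))

    All-pair-IsAtom : ∀ {A} → All G₀ A → All (IsAtom G G₀) (map pair A)
    All-pair-IsAtom []            = []
    All-pair-IsAtom (g∈G₀ ∷ A⊆G₀) = pair-IsAtom g∈G₀ ∷ All-pair-IsAtom A⊆G₀

    square-2∈L : ∀ {A} → IsAtom G G₀ A → InLengthSet G G₀ (A ++ A) 2
    square-2∈L {A} A-atom =
      A ∷ A ∷ [] , ≡.refl , A-atom ∷ A-atom ∷ [] ,
      ↭-reflexive (≡.cong (A ++_) (≡.sym (++-identityʳ A)))

    square-length∈L : ∀ {A} → IsAtom G G₀ A → InLengthSet G G₀ (A ++ A) (length A)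
    square-length∈L {A} ((A⊆G₀ , _) , _) =
      map pair A , length-map pair A , All-pair-IsAtom A⊆G₀ , ++-self↭pairs A

    minΔ∣excess : ∀ {m A} → IsMinDelta G G₀ m → IsAtom G G₀ A → m ∣ length A ∸ 2
    minΔ∣excess {m} {A} ((a , k , a∈H , 1≤m , k∈L , k+m∈L , _) , m≤Δ) A-atom =
      m%n≡0⇒n∣m t m (n<m∧[0<n⇒m≤n]⇒n≡0 (m%n<n t m) (minΔ≤lengthGap m≤Δ e∈H r X∈L X+r∈L))
      where
      instance
        m≢0 : NonZero m
        m≢0 = >-nonZero 1≤m
      t Q r : ℕ
      t = length A ∸ 2
      Q = t / m
      r = t % m
      e : List Carrier
      e = concat (replicate Q a) ++ (A ++ A)
      e∈H : InH G G₀ e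
      e∈H = InH-++ (InH-power Q a∈H) (InH-++ (proj₁ A-atom) (proj₁ A-atom))
      X∈L : InLengthSet G G₀ e (Q * (k + m) + 2)
      X∈L = InLengthSet-++ (InLengthSet-power Q k+m∈L) (square-2∈L A-atom)
      lengths-differ-by-r : Q * k + length A ≡ Q * (k + m) + 2 + r
      lengths-differ-by-r = begin
        Q * k + length A          ≡⟨ ≡.cong (Q * k +_) (≡.sym (m+[n∸m]≡n (IsAtom⇒2≤length A-atom))) ⟩
        Q * k + (2 + t)           ≡⟨ ≡.cong (λ t → Q * k + (2 + t)) (m≡m%n+[m/n]*n t m) ⟩
        Q * k + (2 + (r + Q * m)) ≡⟨ regroup Q k m r ⟩
        Q * (k + m) + 2 + r       ∎
        where
        regroup : ∀ Q k m r → Q * k + (2 + (r + Q * m)) ≡ Q * (k + m) + 2 + r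
        regroup = solve-∀
      X+r∈L : InLengthSet G G₀ e (Q * (k + m) + 2 + r)
      X+r∈L = ≡.subst (InLengthSet G G₀ e) lengths-differ-by-r
                (InLengthSet-++ (InLengthSet-power Q k∈L) (square-length∈L A-atom))

    module _ {d} (d∣excess : ∀ A → IsAtom G G₀ A → d ∣ length A ∸ 2) where

      length-concat-atoms : ∀ {As} → All (IsAtom G G₀) As →
                            ∃[ T ] d ∣ T × length (concat As) ≡ 2 * length As + T
      length-concat-atoms []                          = 0 , d ∣0 , ≡.refl
      length-concat-atoms {A ∷ As} (A-atom ∷ As-atoms) with length-concat-atoms As-atoms
      ... | T , d∣T , |concatAs| = t + T , ∣m∣n⇒∣m+n (d∣excess A A-atom) d∣T , (begin
        length (A ++ concat As)          ≡⟨ length-++ A ⟩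
        length A + length (concat As)    ≡⟨ ≡.cong₂ _+_ (≡.sym (m+[n∸m]≡n (IsAtom⇒2≤length A-atom))) |concatAs| ⟩
        (2 + t) + (2 * length As + T)    ≡⟨ regroup t (length As) T ⟩
        2 * suc (length As) + (t + T)    ∎)
        where
        t : ℕ
        t = length A ∸ 2
        regroup : ∀ t n T → (2 + t) + (2 * n + T) ≡ 2 * suc n + (t + T)
        regroup = solve-∀

      d∣2δ : ∀ {δ} → InDelta G G₀ δ → d ∣ 2 * δ
      d∣2δ {δ} (a , k , _ , _ , (As , |As|≡k , As-atoms , a↭As) , (Bs , |Bs|≡k+δ , Bs-atoms , a↭Bs) , _)
        with length-concat-atoms As-atoms | length-concat-atoms Bs-atoms
      ... | T₁ , d∣T₁ , |concatAs| | T₂ , d∣T₂ , |concatBs| =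
        ∣m+n∣m⇒∣n (≡.subst (d ∣_) (+-cancelˡ-≡ (2 * k) T₁ (T₂ + 2 * δ) lengths) d∣T₁) d∣T₂
        where
        lengths : 2 * k + T₁ ≡ 2 * k + (T₂ + 2 * δ)
        lengths = begin
          2 * k + T₁             ≡⟨ ≡.cong (λ n → 2 * n + T₁) (≡.sym |As|≡k) ⟩
          2 * length As + T₁     ≡⟨ ≡.sym |concatAs| ⟩
          length (concat As)     ≡⟨ ≡.sym (xs↭ys⇒|xs|≡|ys| a↭As) ⟩
          length a               ≡⟨ xs↭ys⇒|xs|≡|ys| a↭Bs ⟩
          length (concat Bs)     ≡⟨ |concatBs| ⟩
          2 * length Bs + T₂     ≡⟨ ≡.cong (λ n → 2 * n + T₂) |Bs|≡k+δ ⟩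
          2 * (k + δ) + T₂       ≡⟨ regroup k δ T₂ ⟩
          2 * k + (T₂ + 2 * δ)   ∎
          where
          regroup : ∀ k δ T → 2 * (k + δ) + T ≡ 2 * k + (T + 2 * δ)
          regroup = solve-∀

¬2∣⇒Coprime-2 : ∀ {n} → ¬ 2 ∣ n → Coprime n 2
¬2∣⇒Coprime-2 ¬2∣n (i∣n , i∣2) =
  [ id , (λ i≡2 → ⊥-elim (¬2∣n (≡.subst (_∣ _) i≡2 i∣n))) ]′ (irreducible[2] i∣2)

m∣n∧n∣2m∧¬2∣n⇒m≡n : ∀ {m n} → m ∣ n → n ∣ 2 * m → ¬ 2 ∣ n → m ≡ n
m∣n∧n∣2m∧¬2∣n⇒m≡n m∣n n∣2m ¬2∣n = ∣-antisym m∣n (coprime-divisor (¬2∣⇒Coprime-2 ¬2∣n) n∣2m)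

lemma4p5 : {c ℓ p : Level} (G : AbelianGroup c ℓ) (G₀ : AbelianGroup.Carrier G → Set p)
    → G₀ Respects AbelianGroup._≈_ G
    → (∀ g → G₀ g → ¬ AbelianGroup._≈_ G g (AbelianGroup.ε G))
    → Σ (AbelianGroup.Carrier G) G₀
    → Σ ℕ (InDelta G G₀)
    → (d : ℕ) → IsAtomLengthGcd G G₀ d
    → (m : ℕ) → IsMinDelta G G₀ m
    → (m ∣ d × d ∣ 2 * m) × (¬ (2 ∣ d) → m ≡ d)
lemma4p5 G G₀ _ zero-free _ _ d (d∣excess , d-greatest) m m-min@(m∈Δ , _) =
  (m∣d , d∣2m) , m∣n∧n∣2m∧¬2∣n⇒m≡n m∣d d∣2m
  where
  m∣d : m ∣ d
  m∣d = d-greatest m (λ _ → minΔ∣excess G G₀ zero-free m-min)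
  d∣2m : d ∣ 2 * m
  d∣2m = d∣2δ G G₀ zero-free d∣excess m∈Δ
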